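{- A signed simple graph $\Sigma$ has a bipartite negation set if and only if the $4$-core of $\Sigma$ has a bipartite negation set. Similarly, $\Sigma$ has an acyclic negation set if and only if the $4$-core of $\Sigma$ has an acyclic negation set.
   Context: A signed graph is a pair $\Sigma=(\Gamma,\sigma)$ with $\sigma: E(\Gamma)\to\{+,-\}$. The sign of a circle (cycle) is the product of the signs of its edges; a signed graph is balanced if every circle is positive. A negation set is a set of edges whose negation (changing the sign of each of its edges) yields a balanced signed graph. An edge set is bipartite (resp. acyclic) if the graph formed by its edges and their endpoints is bipartite (resp. a forest). The $4$-core of a graph is obtained by repeatedly deleting vertices of degree less than $4$ (with their signed edges). -}

module Defs where

open import Data.Nat using (ℕ; _≤_; _<_)
open import Data.Bool using (Bool; true; false; _∧_; not; if_then_else_)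
open import Data.Maybe using (Maybe; just; nothing; is-just)
import Data.Maybe as Maybe
open import Data.Fin using (Fin; _≟_)
open import Data.List using (List; []; _∷_; _++_; [_]; length; zip; foldr; map; filterᵇ; allFin)
open import Data.List.Relation.Unary.All using (All)
open import Data.List.Relation.Unary.Unique.Propositional using (Unique)
open import Data.Product using (Σ; ∃; _×_; _,_; proj₁; proj₂)
open import Relation.Nullary using (¬_)
open import Relation.Nullary.Decidable using (⌊_⌋)
open import Relation.Binary.PropositionalEquality using (_≡_; _≢_)
open import Relation.Binary.Construct.Closure.ReflexiveTransitive using (Star)

data Sign : Set where
  plus minus : Sign

neg : Sign → Sign
neg plus  = minus
neg minus = plus

_·_ : Sign → Sign → Sign
plus  · s = s
minus · s = neg s

-- Raw signed adjacency on vertex set Fin n: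
-- nothing = no edge, just s = an edge with sign s.
Adj : ℕ → Set
Adj n = Fin n → Fin n → Maybe Sign

-- A signed simple graph on vertices Fin n: symmetric, loopless
-- (at most one edge per pair is automatic).
record SignedGraph (n : ℕ) : Set where
  field
    adj    : Adj n
    sym    : ∀ i j → adj i j ≡ adj j i
    irrefl : ∀ i → adj i i ≡ nothing
open SignedGraph public

EdgeSet : ℕ → Set
EdgeSet n = Fin n → Fin n → Bool

cycEdges : ∀ {n} → List (Fin n) → List (Fin n × Fin n)
cycEdges []       = []
cycEdges (v ∷ vs) = zip (v ∷ vs) (vs ++ [ v ])

IsCycleIn : ∀ {n} → (Fin n → Fin n → Set) → List (Fin n) → Set
IsCycleIn E vs = 3 ≤ length vs × Unique vs × All (λ e → E (proj₁ e) (proj₂ e)) (cycEdges vs)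

HasEdge : ∀ {n} → Adj n → Fin n → Fin n → Set
HasEdge g i j = g i j ≢ nothing

edgeSign : Maybe Sign → Sign
edgeSign (just s) = s
edgeSign nothing  = plus

circleSign : ∀ {n} → Adj n → List (Fin n) → Sign
circleSign g vs = foldr (λ e s → edgeSign (g (proj₁ e) (proj₂ e)) · s) plus (cycEdges vs)

Balanced : ∀ {n} → Adj n → Set
Balanced g = ∀ vs → IsCycleIn (HasEdge g) vs → circleSign g vs ≡ plus

negateSet : ∀ {n} → EdgeSet n → Adj n → Adj n
negateSet S g i j = if S i j then Maybe.map neg (g i j) else g i j

IsEdgeSetOf : ∀ {n} → Adj n → EdgeSet n → Set
IsEdgeSetOf g S = (∀ i j → S i j ≡ S j i) × (∀ i j → S i j ≡ true → HasEdge g i j)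

IsNegationSet : ∀ {n} → Adj n → EdgeSet n → Set
IsNegationSet g S = IsEdgeSetOf g S × Balanced (negateSet S g)

InSet : ∀ {n} → EdgeSet n → Fin n → Fin n → Set
InSet S i j = S i j ≡ true

BipartiteSet : ∀ {n} → EdgeSet n → Set
BipartiteSet {n} S = Σ (Fin n → Bool) λ c → ∀ i j → S i j ≡ true → c i ≢ c j

AcyclicSet : ∀ {n} → EdgeSet n → Set
AcyclicSet S = ∀ vs → ¬ IsCycleIn (InSet S) vs

HasBipartiteNegationSet : ∀ {n} → Adj n → Set
HasBipartiteNegationSet g = ∃ λ S → IsNegationSet g S × BipartiteSet S

HasAcyclicNegationSet : ∀ {n} → Adj n → Set
HasAcyclicNegationSet g = ∃ λ S → IsNegationSet g S × AcyclicSet S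

VSet : ℕ → Set
VSet n = Fin n → Bool

allV : ∀ {n} → VSet n
allV _ = true

-- Induced subgraph on the surviving vertices (deleted vertices keep
-- no edges).
restrict : ∀ {n} → VSet n → Adj n → Adj n
restrict U g i j = if U i ∧ U j then g i j else nothing

deg : ∀ {n} → Adj n → VSet n → Fin n → ℕ
deg {n} g U v = length (filterᵇ (λ w → U w ∧ is-just (g v w)) (allFin n))

remove : ∀ {n} → VSet n → Fin n → VSet n
remove U v w = if ⌊ v ≟ w ⌋ then false else U w

data DelStep {n} (g : Adj n) : VSet n → VSet n → Set where
  del : ∀ U v → U v ≡ true → deg g U v < 4 → DelStep g U (remove U v)

IsFourCore : ∀ {n} → Adj n → VSet n → Set
IsFourCore g U = Star (DelStep g) allV U × (∀ v → U v ≡ true → 4 ≤ deg g U v)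

-- A negation set of Σ restricts to a negation set of the 4-core, and being bipartite or
-- acyclic passes to subsets. Conversely, undo the deletions one vertex at a time. If S is a
-- negation set of Σ − v, the negated graph is balanced, so by Harary's theorem it has a
-- potential p with σ(ij) = p(i) p(j). Each of the at most three neighbours w of v asks for
-- p(v) = σ(vw) p(w); taking the majority value leaves at most one inconsistent edge at v,
-- and adding it to S attaches v to S by a pendant edge, which keeps S bipartite and acyclic.
-- Harary's theorem is proved by merging components along edges while keeping a potential
-- realised by walks: an edge inside a component closes a walk, and closed walks in a
-- balanced graph are positive, since they shorten to circles.

module Submission where

open import Algebra.Bundles using (CommutativeMonoid)
open import Algebra.Structures using (IsCommutativeMonoid)
open import Data.Bool using (Bool; true; false; _∧_; not; if_then_else_)
open import Data.Bool.Properties using (∧-comm; ∧-zeroʳ; not-¬; T-≡)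
import Data.Bool as Bool
open import Data.Empty using (⊥-elim)
open import Data.Fin using (Fin)
import Data.Fin as Fin
open import Data.Fin.Properties using (any?)
open import Data.List using (List; []; _∷_; _++_; [_]; length; zip; foldr; filterᵇ; allFin; cartesianProduct)
open import Data.List.Membership.Propositional using (_∈_; _∉_)
open import Data.List.Membership.Propositional.Properties
  using (∈-++⁺ʳ; ∈-++⁻; ∈-∃++; ∈-allFin; ∈-cartesianProduct⁺; ∈-filter⁺)
import Data.List.Membership.DecPropositional as DecMembership
open import Data.List.Properties using (++-assoc; ++-identityʳ; length-++-comm)
open import Data.List.Relation.Unary.All as All using (All; []; _∷_)
open import Data.List.Relation.Unary.All.Properties using (¬Any⇒All¬; ++⁻ˡ; ++⁻ʳ) renaming (++⁺ to All-++⁺)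
open import Data.List.Relation.Unary.AllPairs using ([]; _∷_)
open import Data.List.Relation.Unary.Any using (here; there)
open import Data.List.Relation.Unary.Unique.Propositional using (Unique)
import Data.List.Relation.Unary.Unique.Propositional.Properties as Unique
open import Data.Maybe using (Maybe; just; nothing; is-just)
import Data.Maybe as Maybe
open import Data.Nat using (ℕ; suc; _+_; _≤_; _<_; z≤n; s≤s)
open import Data.Nat.Properties using (+-suc; m+n≤o⇒n≤o)
open import Data.Product using (Σ; ∃; ∃₂; _×_; _,_; proj₁; proj₂)
open import Data.Sum using (_⊎_; inj₁; inj₂)
open import Data.Vec.Functional using (updateAt)
open import Data.Vec.Functional.Properties using (updateAt-updates; updateAt-minimal)
open import Function using (_∘_; case_of_)
open import Function.Bundles using (_⇔_; mk⇔; Equivalence)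
open import Relation.Binary.Construct.Closure.ReflexiveTransitive using (Star; ε; _◅_)
open import Relation.Binary.PropositionalEquality hiding ([_])
open import Relation.Binary.PropositionalEquality.Algebra using (isMagma)
open import Relation.Nullary using (Dec; yes; no)
open import Relation.Nullary.Decidable using (T?; toSum)

open import Defs hiding (sym)

·-assoc : ∀ a b c → (a · b) · c ≡ a · (b · c)
·-assoc plus  b     c     = refl
·-assoc minus plus  c     = refl
·-assoc minus minus plus  = refl
·-assoc minus minus minus = refl

·-comm : ∀ a b → a · b ≡ b · a
·-comm plus  plus  = refl
·-comm plus  minus = refl
·-comm minus plus  = refl
·-comm minus minus = refl

·-identityʳ : ∀ a → a · plus ≡ a
·-identityʳ plus  = refl
·-identityʳ minus = refl

·-selfInverse : ∀ a → a · a ≡ plus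
·-selfInverse plus  = refl
·-selfInverse minus = refl

xy≡plus⇒x≡y : ∀ {a b} → a · b ≡ plus → a ≡ b
xy≡plus⇒x≡y {plus}  {plus}  _ = refl
xy≡plus⇒x≡y {minus} {minus} _ = refl
xy≡plus⇒x≡y {plus}  {minus} ()
xy≡plus⇒x≡y {minus} {plus}  ()

·-isCommutativeMonoid : IsCommutativeMonoid _≡_ _·_ plus
·-isCommutativeMonoid = record
  { isMonoid = record
    { isSemigroup = record { isMagma = isMagma _·_ ; assoc = ·-assoc }
    ; identity    = (λ _ → refl) , ·-identityʳ
    }
  ; comm = ·-comm
  }

·-commutativeMonoid : CommutativeMonoid _ _
·-commutativeMonoid = record { isCommutativeMonoid = ·-isCommutativeMonoid }

open import Algebra.Solver.CommutativeMonoid ·-commutativeMonoid using (solve; _⊜_; _⊕_)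

tx·ty≡xy : ∀ t x y → (t · x) · (t · y) ≡ x · y
tx·ty≡xy t x y rewrite solve 3 (λ t x y → (t ⊕ x) ⊕ (t ⊕ y) ⊜ (t ⊕ t) ⊕ (x ⊕ y)) refl t x y
                    | ·-selfInverse t = refl

xy·yz≡xz : ∀ x y z → (x · y) · (y · z) ≡ x · z
xy·yz≡xz x y z rewrite solve 3 (λ x y z → (x ⊕ y) ⊕ (y ⊕ z) ⊜ (y ⊕ y) ⊕ (x ⊕ z)) refl x y z
                        | ·-selfInverse y = refl

xsp·s≡xp : ∀ x s p → (x · (s · p)) · s ≡ x · p
xsp·s≡xp x s p rewrite solve 3 (λ x s p → (x ⊕ (s ⊕ p)) ⊕ s ⊜ (s ⊕ s) ⊕ (x ⊕ p)) refl x s p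
                       | ·-selfInverse s = refl

signOf : Bool → Sign
signOf false = plus
signOf true  = minus

isMinus : Sign → Bool
isMinus plus  = false
isMinus minus = true

-- differs x s = isMinus (x · s), spelled out so that differs plus and differs minus are
-- definitionally isMinus and not ∘ isMinus.
differs : Sign → Sign → Bool
differs plus  s = isMinus s
differs minus s = not (isMinus s)

signOf-differs : ∀ x s → signOf (differs x s) ≡ x · s
signOf-differs plus  plus  = refl
signOf-differs plus  minus = refl
signOf-differs minus plus  = refl
signOf-differs minus minus = refl

module _ {A : Set} where

  Unique-++ˡ : ∀ (xs : List A) {ys} → Unique (xs ++ ys) → Unique xs
  Unique-++ˡ []       _        = []
  Unique-++ˡ (x ∷ xs) (x∉ ∷ u) = ++⁻ˡ xs x∉ ∷ Unique-++ˡ xs u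

  Unique-++ʳ : ∀ (xs : List A) {ys} → Unique (xs ++ ys) → Unique ys
  Unique-++ʳ []       u       = u
  Unique-++ʳ (x ∷ xs) (_ ∷ u) = Unique-++ʳ xs u

  Unique-++-disjoint : ∀ (xs : List A) {ys y} → Unique (xs ++ ys) → y ∈ ys → y ∉ xs
  Unique-++-disjoint (x ∷ xs) (x∉ ∷ _) y∈ys (here refl) = All.lookup (++⁻ʳ xs x∉) y∈ys refl
  Unique-++-disjoint (x ∷ xs) (_ ∷ u)  y∈ys (there y∈xs) = Unique-++-disjoint xs u y∈ys y∈xs

  ∈-zip⁻ : ∀ {B : Set} {xs : List A} {ys : List B} {e} → e ∈ zip xs ys → proj₁ e ∈ xs × proj₂ e ∈ ys
  ∈-zip⁻ {xs = _ ∷ _} {_ ∷ _} (here refl) = here refl , here refl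
  ∈-zip⁻ {xs = _ ∷ _} {_ ∷ _} (there e∈) = let x∈ , y∈ = ∈-zip⁻ e∈ in there x∈ , there y∈

  ∈-snoc⁻ : ∀ {x y : A} xs → y ∈ xs ++ [ x ] → y ∈ x ∷ xs
  ∈-snoc⁻ xs y∈ with ∈-++⁻ xs y∈
  ... | inj₁ y∈xs        = there y∈xs
  ... | inj₂ (here refl) = here refl

  zip-rotate : ∀ (y : A) xs a x → zip (y ∷ xs ++ [ a ]) ((xs ++ [ a ]) ++ [ x ]) ≡ zip (y ∷ xs) (xs ++ [ a ]) ++ [ (a , x) ]
  zip-rotate y []       a x = refl
  zip-rotate y (z ∷ zs) a x = cong ((y , z) ∷_) (zip-rotate z zs a x)

cycEdges-∈ : ∀ {n} (vs : List (Fin n)) {e} → e ∈ cycEdges vs → proj₁ e ∈ vs × proj₂ e ∈ vs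
cycEdges-∈ (v ∷ vs) e∈ = let i∈ , j∈ = ∈-zip⁻ e∈ in i∈ , ∈-snoc⁻ vs j∈

module _ {n} {E : Fin n → Fin n → Set} where

  IsCycleIn-rotate₁ : ∀ a l → IsCycleIn E (a ∷ l) → IsCycleIn E (l ++ [ a ])
  IsCycleIn-rotate₁ a []      c = c
  IsCycleIn-rotate₁ a (x ∷ l) (3≤ , a∉ ∷ l! , ax ∷ es) =
    subst (3 ≤_) (sym (length-++-comm (x ∷ l) [ a ])) 3≤ ,
    Unique.++⁺ l! ([] ∷ []) (λ { (y∈l , here refl) → All.lookup a∉ y∈l refl }) ,
    subst (All _) (sym (zip-rotate x l a x)) (All-++⁺ es (ax ∷ []))

  IsCycleIn-rotate : ∀ as bs → IsCycleIn E (as ++ bs) → IsCycleIn E (bs ++ as)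
  IsCycleIn-rotate []       bs c = subst (IsCycleIn E) (sym (++-identityʳ bs)) c
  IsCycleIn-rotate (a ∷ as) bs c =
    subst (IsCycleIn E) (++-assoc bs [ a ] as)
      (IsCycleIn-rotate as (bs ++ [ a ])
        (subst (IsCycleIn E) (++-assoc as bs [ a ]) (IsCycleIn-rotate₁ a (as ++ bs) c)))

  IsCycleIn-mono : ∀ {F : Fin n → Fin n → Set} {vs} →
                   (∀ {i j} → i ∈ vs → j ∈ vs → E i j → F i j) → IsCycleIn E vs → IsCycleIn F vs
  IsCycleIn-mono {vs = vs} E⇒F (3≤ , vs! , es) =
    3≤ , vs! , All.tabulate λ e∈ → let i∈ , j∈ = cycEdges-∈ vs e∈ in E⇒F i∈ j∈ (All.lookup es e∈)

  private
    lastEdge : ∀ a c l b → All (λ e → E (proj₁ e) (proj₂ e)) (zip (a ∷ c ∷ l) (c ∷ l ++ [ b ])) →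
               ∃ λ y → y ∈ c ∷ l × E y b
    lastEdge a c []      b (_ ∷ cb ∷ []) = c , here refl , cb
    lastEdge a c (d ∷ l) b (_ ∷ es)      = let y , y∈ , yb = lastEdge c d l b es in y , there y∈ , yb

    head-neighbours : ∀ {v} zs → IsCycleIn E (v ∷ zs) → ∃₂ λ x y → x ≢ y × E v x × E y v
    head-neighbours []          (s≤s () , _)
    head-neighbours (x ∷ [])    (s≤s (s≤s ()) , _)
    head-neighbours (x ∷ c ∷ l) (_ , _ ∷ x∉ ∷ _ , vx ∷ es) =
      let y , y∈ , yv = lastEdge x c l _ es in x , y , All.lookup x∉ y∈ , vx , yv

  cycle-neighbours : ∀ {vs v} → IsCycleIn E vs → v ∈ vs → ∃₂ λ x y → x ≢ y × E v x × E y v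
  cycle-neighbours c v∈vs with ∈-∃++ v∈vs
  ... | as , bs , refl = head-neighbours (bs ++ as) (IsCycleIn-rotate as (_ ∷ bs) c)

-- Potentials and Harary's theorem

edgesSign : ∀ {n} → Adj n → List (Fin n × Fin n) → Sign
edgesSign g = foldr (λ e s → edgeSign (g (proj₁ e) (proj₂ e)) · s) plus

record Potential {n} (g : Adj n) : Set where
  field
    pot        : Fin n → Sign
    consistent : ∀ i j → HasEdge g i j → edgeSign (g i j) ≡ pot i · pot j

module _ {n} {g : Adj n} (P : Potential g) where
  open Potential P renaming (pot to p)

  private
    telescope : ∀ x xs y → All (λ e → HasEdge g (proj₁ e) (proj₂ e)) (zip (x ∷ xs) (xs ++ [ y ])) →
                edgesSign g (zip (x ∷ xs) (xs ++ [ y ])) ≡ p x · p y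
    telescope x []       y (xy ∷ [])  = trans (·-identityʳ _) (consistent x y xy)
    telescope x (z ∷ zs) y (xz ∷ es) =
      trans (cong₂ _·_ (consistent x z xz) (telescope z zs y es)) (xy·yz≡xz (p x) (p z) (p y))

  potential⇒balanced : Balanced g
  potential⇒balanced (x ∷ xs) (_ , _ , es) = trans (telescope x xs x es) (·-selfInverse (p x))


module Walks {n : ℕ} (Γ : SignedGraph n) where

  open DecMembership (Fin._≟_ {n}) using (_∈?_)

  g : Adj n
  g = adj Γ

  σ : Fin n → Fin n → Sign
  σ i j = edgeSign (g i j)

  σ-sym : ∀ i j → σ i j ≡ σ j i
  σ-sym i j = cong edgeSign (SignedGraph.sym Γ i j)

  infixr 5 _∷_ _++ʷ_

  data Walk : Fin n → Fin n → Set where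
    []  : ∀ {a} → Walk a a
    _∷_ : ∀ {a b c} → HasEdge g a b → Walk b c → Walk a c

  edges : ∀ {a b} → Walk a b → List (Fin n × Fin n)
  edges []                = []
  edges (_∷_ {a} {b} _ w) = (a , b) ∷ edges w

  sign : ∀ {a b} → Walk a b → Sign
  sign w = edgesSign g (edges w)

  departures : ∀ {a b} → Walk a b → List (Fin n)
  departures []            = []
  departures (_∷_ {a} _ w) = a ∷ departures w

  vertices : ∀ {a b} → Walk a b → List (Fin n)
  vertices {b = b} w = departures w ++ [ b ]

  _++ʷ_ : ∀ {a b c} → Walk a b → Walk b c → Walk a c
  []      ++ʷ w′ = w′
  (e ∷ w) ++ʷ w′ = e ∷ (w ++ʷ w′)

  sign-++ʷ : ∀ {a b c} (w : Walk a b) (w′ : Walk b c) → sign (w ++ʷ w′) ≡ sign w · sign w′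
  sign-++ʷ []                w′ = refl
  sign-++ʷ (_∷_ {a} {b} _ w) w′ rewrite sign-++ʷ w w′ = sym (·-assoc (σ a b) (sign w) (sign w′))

  vertices-++ʷ : ∀ {a b c} (w : Walk a b) (w′ : Walk b c) → vertices (w ++ʷ w′) ≡ departures w ++ vertices w′
  vertices-++ʷ []      w′ = refl
  vertices-++ʷ (e ∷ w) w′ = cong (_ ∷_) (vertices-++ʷ w w′)

  start∈vertices : ∀ {a b} (w : Walk a b) → a ∈ vertices w
  start∈vertices []      = here refl
  start∈vertices (e ∷ w) = here refl

  end∈vertices : ∀ {a b} (w : Walk a b) → b ∈ vertices w
  end∈vertices w = ∈-++⁺ʳ (departures w) (here refl)

  split : ∀ {a b c} (w : Walk a c) → b ∈ vertices w →
          Σ (Walk a b) λ w₁ → Σ (Walk b c) λ w₂ → w ≡ w₁ ++ʷ w₂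
  split []      (here refl) = [] , [] , refl
  split (e ∷ w) (here refl) = [] , e ∷ w , refl
  split (e ∷ w) (there b∈w) with split w b∈w
  ... | w₁ , w₂ , refl = e ∷ w₁ , w₂ , refl

  edges-present : ∀ {a b} (w : Walk a b) → All (λ e → HasEdge g (proj₁ e) (proj₂ e)) (edges w)
  edges-present []      = []
  edges-present (e ∷ w) = e ∷ edges-present w

  cycEdges-departures : ∀ {a b c} (e : HasEdge g a b) (w : Walk b c) →
                    zip (a ∷ departures w) (vertices w) ≡ edges (e ∷ w)
  cycEdges-departures e []       = refl
  cycEdges-departures e (e′ ∷ w) = cong (_ ∷_) (cycEdges-departures e′ w)

  module _ (balanced : Balanced g) where

    closedPath-positive : ∀ {a b} (e : HasEdge g a b) (w : Walk b a) →
                          Unique (a ∷ departures w) → sign (e ∷ w) ≡ plus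
    closedPath-positive {a} e [] _ = ⊥-elim (e (irrefl Γ a))
    closedPath-positive {a} {b} e (_ ∷ []) _
      rewrite σ-sym b a | ·-identityʳ (σ a b) = ·-selfInverse (σ a b)
    closedPath-positive {a} e w@(_ ∷ _ ∷ _) u =
      subst (λ es → edgesSign g es ≡ plus) (cycEdges-departures e w)
        (balanced (a ∷ departures w)
          (s≤s (s≤s (s≤s z≤n)) , u , subst (All _) (sym (cycEdges-departures e w)) (edges-present (e ∷ w))))

    -- If the new first vertex already lies on the path, the detour back to it is a circle,
    -- hence positive, and is dropped.
    toPath : ∀ {a b} (w : Walk a b) → Σ (Walk a b) λ p → Unique (vertices p) × sign p ≡ sign w
    toPath [] = [] , [] ∷ [] , refl
    toPath (_∷_ {a} {c} e w) with toPath w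
    ... | p , p! , sp with a ∈? vertices p
    ...   | no a∉p = e ∷ p , ¬Any⇒All¬ _ a∉p ∷ p! , cong (σ a c ·_) sp
    ...   | yes a∈p with split p a∈p
    ...     | p₁ , p₂ , refl = p₂ , Unique-++ʳ (departures p₁) p₁₂! , sign-p₂
      where
      open ≡-Reasoning
      p₁₂! : Unique (departures p₁ ++ vertices p₂)
      p₁₂! = subst Unique (vertices-++ʷ p₁ p₂) p!
      cycle-positive : σ a c · sign p₁ ≡ plus
      cycle-positive = closedPath-positive e p₁
        (¬Any⇒All¬ _ (Unique-++-disjoint (departures p₁) p₁₂! (start∈vertices p₂)) ∷ Unique-++ˡ (departures p₁) p₁₂!)
      sign-p₂ : sign p₂ ≡ σ a c · sign w
      sign-p₂ = begin
        sign p₂                       ≡⟨ cong (_· sign p₂) cycle-positive ⟨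
        (σ a c · sign p₁) · sign p₂   ≡⟨ ·-assoc (σ a c) (sign p₁) (sign p₂) ⟩
        σ a c · (sign p₁ · sign p₂)   ≡⟨ cong (σ a c ·_) (sign-++ʷ p₁ p₂) ⟨
        σ a c · sign (p₁ ++ʷ p₂)      ≡⟨ cong (σ a c ·_) sp ⟩
        σ a c · sign w                ∎

    closedWalk-positive : ∀ {a} (w : Walk a a) → sign w ≡ plus
    closedWalk-positive w with toPath w
    ... | []    , _        , sp = sym sp
    ... | e ∷ p , a∉p ∷ _ , _  = ⊥-elim (All.lookup a∉p (end∈vertices p) refl)

  hasEdge? : ∀ a b → Dec (HasEdge g a b)
  hasEdge? a b with g a b
  ... | just _  = yes λ ()
  ... | nothing = no λ ¬ab → ¬ab refl

  Connects : (Fin n → Fin n) → (Fin n → Sign) → Set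
  Connects comp p = ∀ i j → comp i ≡ comp j → Σ (Walk i j) λ w → sign w ≡ p i · p j

  Joins : (Fin n → Fin n) → Fin n × Fin n → Set
  Joins comp e = HasEdge g (proj₁ e) (proj₂ e) → comp (proj₁ e) ≡ comp (proj₂ e)

  record Labelling (L : List (Fin n × Fin n)) : Set where
    field
      comp     : Fin n → Fin n
      pot      : Fin n → Sign
      connects : Connects comp pot
      joins    : All (Joins comp) L

  module Merge {L} (C : Labelling L) {a b} (ab : HasEdge g a b)
               (a≁b : Labelling.comp C a ≢ Labelling.comp C b) where
    open Labelling C

    relabel : Fin n → Fin n
    relabel x with x Fin.≟ comp b
    ... | yes _ = comp a
    ... | no  _ = x

    -- Switching b's component by pot b · σ a b · pot a makes pot′ b = σ a b · pot a.
    switch : Fin n → Sign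
    switch x with x Fin.≟ comp b
    ... | yes _ = pot b · (σ a b · pot a)
    ... | no  _ = plus

    pot′ : Fin n → Sign
    pot′ i = switch (comp i) · pot i

    relabel-merges : ∀ {x y} → relabel x ≡ relabel y → x ≢ y →
                     (x ≡ comp b × y ≡ comp a) ⊎ (x ≡ comp a × y ≡ comp b)
    relabel-merges {x} {y} eq x≢y with x Fin.≟ comp b | y Fin.≟ comp b
    ... | yes x≡b | yes y≡b = ⊥-elim (x≢y (trans x≡b (sym y≡b)))
    ... | yes x≡b | no  _   = inj₁ (x≡b , sym eq)
    ... | no  _   | yes y≡b = inj₂ (eq , y≡b)
    ... | no  _   | no  _   = ⊥-elim (x≢y eq)

    relabel-joins : relabel (comp a) ≡ relabel (comp b)
    relabel-joins with comp a Fin.≟ comp b | comp b Fin.≟ comp b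
    ... | yes a∼b | _      = ⊥-elim (a≁b a∼b)
    ... | no  _   | yes _  = refl
    ... | no  _   | no b≁b = ⊥-elim (b≁b refl)

    pot′-absorbed : ∀ i → comp i ≡ comp b → pot′ i ≡ (pot b · (σ a b · pot a)) · pot i
    pot′-absorbed i i∼b with comp i Fin.≟ comp b
    ... | yes _   = refl
    ... | no  i≁b = ⊥-elim (i≁b i∼b)

    pot′-kept : ∀ i → comp i ≡ comp a → pot′ i ≡ pot i
    pot′-kept i i∼a with comp i Fin.≟ comp b
    ... | yes i∼b = ⊥-elim (a≁b (trans (sym i∼a) i∼b))
    ... | no  _   = refl

    connects′ : Connects (relabel ∘ comp) pot′
    connects′ i j i≈j with comp i Fin.≟ comp j
    ... | yes i∼j =
      let w , sw = connects i j i∼j in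
      w , trans sw (sym (trans (cong (λ t → (switch (comp i) · pot i) · (t · pot j)) (cong switch (sym i∼j)))
                               (tx·ty≡xy (switch (comp i)) (pot i) (pot j))))
    ... | no i≁j with relabel-merges i≈j i≁j
    ...   | inj₁ (i∼b , j∼a) =
      let w₁ , s₁ = connects i b i∼b ; w₂ , s₂ = connects a j (sym j∼a)
          ba = λ e → ab (trans (SignedGraph.sym Γ a b) e) in
      w₁ ++ʷ ba ∷ w₂ ,
      (begin
        sign (w₁ ++ʷ ba ∷ w₂)                           ≡⟨ sign-++ʷ w₁ (ba ∷ w₂) ⟩
        sign w₁ · (σ b a · sign w₂)                     ≡⟨ cong₂ (λ x y → x · (y · sign w₂)) s₁ (σ-sym b a) ⟩
        (pot i · pot b) · (σ a b · sign w₂)             ≡⟨ cong (λ x → (pot i · pot b) · (σ a b · x)) s₂ ⟩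
        (pot i · pot b) · (σ a b · (pot a · pot j))     ≡⟨ solve 5 (λ i b s a j → (i ⊕ b) ⊕ (s ⊕ (a ⊕ j)) ⊜ ((b ⊕ (s ⊕ a)) ⊕ i) ⊕ j) refl
                                                             (pot i) (pot b) (σ a b) (pot a) (pot j) ⟩
        ((pot b · (σ a b · pot a)) · pot i) · pot j     ≡⟨ cong₂ _·_ (pot′-absorbed i i∼b) (pot′-kept j j∼a) ⟨
        pot′ i · pot′ j                                 ∎)
      where open ≡-Reasoning
    ...   | inj₂ (i∼a , j∼b) =
      let w₁ , s₁ = connects i a i∼a ; w₂ , s₂ = connects b j (sym j∼b) in
      w₁ ++ʷ ab ∷ w₂ ,
      (begin
        sign (w₁ ++ʷ ab ∷ w₂)                           ≡⟨ sign-++ʷ w₁ (ab ∷ w₂) ⟩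
        sign w₁ · (σ a b · sign w₂)                     ≡⟨ cong₂ (λ x y → x · (σ a b · y)) s₁ s₂ ⟩
        (pot i · pot a) · (σ a b · (pot b · pot j))     ≡⟨ solve 5 (λ i a s b j → (i ⊕ a) ⊕ (s ⊕ (b ⊕ j)) ⊜ i ⊕ ((b ⊕ (s ⊕ a)) ⊕ j)) refl
                                                             (pot i) (pot a) (σ a b) (pot b) (pot j) ⟩
        pot i · ((pot b · (σ a b · pot a)) · pot j)     ≡⟨ cong₂ _·_ (pot′-kept i i∼a) (pot′-absorbed j j∼b) ⟨
        pot′ i · pot′ j                                 ∎)
      where open ≡-Reasoning

    merged : Labelling ((a , b) ∷ L)
    merged = record
      { comp     = relabel ∘ comp
      ; pot      = pot′
      ; connects = connects′
      ; joins    = (λ _ → relabel-joins) ∷ All.map (λ joined → cong relabel ∘ joined) joins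
      }

  alreadyJoined : ∀ {L} e (C : Labelling L) → Joins (Labelling.comp C) e → Labelling (e ∷ L)
  alreadyJoined e C joined = record { Labelling C ; joins = joined ∷ Labelling.joins C }

  addPair : ∀ {L} a b → Labelling L → Labelling ((a , b) ∷ L)
  addPair a b C with Labelling.comp C a Fin.≟ Labelling.comp C b | hasEdge? a b
  ... | yes a∼b | _      = alreadyJoined (a , b) C λ _ → a∼b
  ... | no  _   | no ¬ab = alreadyJoined (a , b) C λ ab → ⊥-elim (¬ab ab)
  ... | no  a≁b | yes ab = Merge.merged C ab a≁b

  labelling : ∀ L → Labelling L
  labelling []            = record { comp = λ i → i ; pot = λ _ → plus ; connects = λ { i .i refl → [] , refl } ; joins = [] }
  labelling ((a , b) ∷ L) = addPair a b (labelling L)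

  -- An edge ij closes the walk from j to i in its component, and closed walks are positive.
  balanced⇒potential : Balanced g → Potential g
  balanced⇒potential balanced = record { pot = pot ; consistent = consistent }
    where
    open Labelling (labelling (cartesianProduct (allFin n) (allFin n)))
    consistent : ∀ i j → HasEdge g i j → σ i j ≡ pot i · pot j
    consistent i j ij =
      let w , sw = connects j i (sym (All.lookup joins (∈-cartesianProduct⁺ (∈-allFin i) (∈-allFin j)) ij)) in
      xy≡plus⇒x≡y (trans (cong (σ i j ·_) (trans (·-comm (pot i) (pot j)) (sym sw)))
                         (closedWalk-positive balanced (ij ∷ w)))

negateIf : Bool → Maybe Sign → Maybe Sign
negateIf b m = if b then Maybe.map neg m else m

negateIf-nothing : ∀ b → negateIf b nothing ≡ nothing
negateIf-nothing true  = refl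
negateIf-nothing false = refl

negateIf-edge : ∀ b {m} → negateIf b m ≢ nothing → m ≢ nothing
negateIf-edge b {m} h refl = h (negateIf-nothing b)

edgeSign-negateIf : ∀ b {m} → m ≢ nothing → edgeSign (negateIf b m) ≡ signOf b · edgeSign m
edgeSign-negateIf true  {just s}  _ = refl
edgeSign-negateIf false {just s}  _ = refl
edgeSign-negateIf _     {nothing} h = ⊥-elim (h refl)

is-just⇒≢nothing : ∀ {m : Maybe Sign} → is-just m ≡ true → m ≢ nothing
is-just⇒≢nothing {just _} _ ()

≢nothing⇒is-just : ∀ {m : Maybe Sign} → m ≢ nothing → is-just m ≡ true
≢nothing⇒is-just {just _}  _ = refl
≢nothing⇒is-just {nothing} h = ⊥-elim (h refl)

∧-true⁻ : ∀ {x y} → x ∧ y ≡ true → x ≡ true × y ≡ true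
∧-true⁻ {true} {true} _ = refl , refl

negateGraph : ∀ {n} (S : EdgeSet n) → (∀ i j → S i j ≡ S j i) → SignedGraph n → SignedGraph n
negateGraph S S-sym Γ = record
  { adj    = negateSet S (adj Γ)
  ; sym    = λ i j → cong₂ negateIf (S-sym i j) (SignedGraph.sym Γ i j)
  ; irrefl = λ i → trans (cong (negateIf (S i i)) (irrefl Γ i)) (negateIf-nothing (S i i))
  }

restrict-irrefl : ∀ {n} (U : VSet n) {g : Adj n} → (∀ i → g i i ≡ nothing) → ∀ i → restrict U g i i ≡ nothing
restrict-irrefl U g-irrefl i with U i ∧ U i
... | true  = g-irrefl i
... | false = refl

restrictGraph : ∀ {n} → VSet n → SignedGraph n → SignedGraph n
restrictGraph U Γ = record
  { adj    = restrict U (adj Γ)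
  ; sym    = λ i j → cong₂ (λ b m → if b then m else nothing) (∧-comm (U i) (U j)) (SignedGraph.sym Γ i j)
  ; irrefl = restrict-irrefl U {adj Γ} (irrefl Γ)
  }

module _ {n} {U : VSet n} {g : Adj n} where

  restrict-inside : ∀ {i j} → U i ≡ true → U j ≡ true → restrict U g i j ≡ g i j
  restrict-inside Ui Uj rewrite Ui | Uj = refl

  restrict-edge : ∀ {i j} → HasEdge (restrict U g) i j → (U i ∧ U j ≡ true) × (restrict U g i j ≡ g i j)
  restrict-edge {i} {j} h with U i ∧ U j
  ... | true  = refl , refl
  ... | false = ⊥-elim (h refl)

  potential-restrict : Potential g → Potential (restrict U g)
  potential-restrict P = record { pot = pot ; consistent = consistent′ }
    where
    open Potential P
    consistent′ : ∀ i j → HasEdge (restrict U g) i j → edgeSign (restrict U g i j) ≡ pot i · pot j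
    consistent′ i j h = let _ , eq = restrict-edge h in trans (cong edgeSign eq) (consistent i j λ e → h (trans eq e))

potential-resp : ∀ {n} {g g′ : Adj n} → (∀ i j → g i j ≡ g′ i j) → Potential g → Potential g′
potential-resp {g = g} {g′} g≗g′ P = record { pot = pot ; consistent = consistent′ }
  where
  open Potential P
  consistent′ : ∀ i j → HasEdge g′ i j → edgeSign (g′ i j) ≡ pot i · pot j
  consistent′ i j h = trans (cong edgeSign (sym (g≗g′ i j))) (consistent i j λ e → h (trans (sym (g≗g′ i j)) e))

remove-other : ∀ {n} {V : VSet n} {v w} → w ≢ v → remove V v w ≡ V w
remove-other {v = v} {w} w≢v with v Fin.≟ w
... | yes v≡w = ⊥-elim (w≢v (sym v≡w))
... | no  _   = refl

restrict-remove : ∀ {n} {V : VSet n} {v} {g : Adj n} {i j} → i ≢ v → j ≢ v →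
                  restrict (remove V v) g i j ≡ restrict V g i j
restrict-remove {V = V} {g = g} {i} {j} i≢v j≢v =
  cong₂ (λ a b → if a ∧ b then g i j else nothing) (remove-other {V = V} i≢v) (remove-other {V = V} j≢v)

_⊆ₑ_ : ∀ {n} → EdgeSet n → EdgeSet n → Set
S ⊆ₑ T = ∀ i j → S i j ≡ true → T i j ≡ true

bipartite-antitone : ∀ {n} {S T : EdgeSet n} → S ⊆ₑ T → BipartiteSet T → BipartiteSet S
bipartite-antitone S⊆T (c , proper) = c , λ i j e → proper i j (S⊆T i j e)

acyclic-antitone : ∀ {n} {S T : EdgeSet n} → S ⊆ₑ T → AcyclicSet T → AcyclicSet S
acyclic-antitone S⊆T acyclic vs cycle = acyclic vs (IsCycleIn-mono (λ {i} {j} _ _ → S⊆T i j) cycle)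

restrictSet : ∀ {n} → VSet n → EdgeSet n → EdgeSet n
restrictSet U S i j = if U i ∧ U j then S i j else false

module _ {n} {U : VSet n} {S : EdgeSet n} where

  restrictSet-⊆ : restrictSet U S ⊆ₑ S
  restrictSet-⊆ i j e with U i ∧ U j
  ... | true = e

  restrictSet-edgeSet : ∀ {g} → IsEdgeSetOf g S → IsEdgeSetOf (restrict U g) (restrictSet U S)
  restrictSet-edgeSet {g} (S-sym , S-edges) =
    (λ i j → cong₂ (λ b s → if b then s else false) (∧-comm (U i) (U j)) (S-sym i j)) , edges
    where
    edges : ∀ i j → restrictSet U S i j ≡ true → HasEdge (restrict U g) i j
    edges i j e with U i ∧ U j
    ... | true = S-edges i j e

  negateSet-restrictSet : ∀ {g} i j → negateSet (restrictSet U S) (restrict U g) i j ≡ restrict U (negateSet S g) i j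
  negateSet-restrictSet i j with U i ∧ U j
  ... | true  = refl
  ... | false = refl

AtMostOne : ∀ {n} → (Fin n → Bool) → Set
AtMostOne t = ∀ {a b} → t a ≡ true → t b ≡ true → a ≡ b

replaceStar : ∀ {n} → EdgeSet n → Fin n → (Fin n → Bool) → EdgeSet n
replaceStar S v t i j with i Fin.≟ v | j Fin.≟ v
... | yes _ | _     = t j
... | no  _ | yes _ = t i
... | no  _ | no  _ = S i j

module StarReplacement {n} (S : EdgeSet n) (v : Fin n) (t : Fin n → Bool) where

  replaceStar-row : ∀ j → replaceStar S v t v j ≡ t j
  replaceStar-row j with v Fin.≟ v
  ... | yes _   = refl
  ... | no  v≢v = ⊥-elim (v≢v refl)

  replaceStar-col : ∀ i → replaceStar S v t i v ≡ t i
  replaceStar-col i with i Fin.≟ v | v Fin.≟ v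
  ... | yes refl | _       = refl
  ... | no  _    | yes _   = refl
  ... | no  _    | no  v≢v = ⊥-elim (v≢v refl)

  replaceStar-off : ∀ {i j} → i ≢ v → j ≢ v → replaceStar S v t i j ≡ S i j
  replaceStar-off {i} {j} i≢v j≢v with i Fin.≟ v | j Fin.≟ v
  ... | yes i≡v | _       = ⊥-elim (i≢v i≡v)
  ... | no  _   | yes j≡v = ⊥-elim (j≢v j≡v)
  ... | no  _   | no  _   = refl

  replaceStar-sym : (∀ i j → S i j ≡ S j i) → ∀ i j → replaceStar S v t i j ≡ replaceStar S v t j i
  replaceStar-sym S-sym i j with toSum (i Fin.≟ v) | toSum (j Fin.≟ v)
  ... | inj₁ refl | _         = trans (replaceStar-row j) (sym (replaceStar-col j))
  ... | inj₂ _    | inj₁ refl = trans (replaceStar-col i) (sym (replaceStar-row i))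
  ... | inj₂ i≢v  | inj₂ j≢v  = trans (replaceStar-off i≢v j≢v) (trans (S-sym i j) (sym (replaceStar-off j≢v i≢v)))

  bipartite-replaceStar : AtMostOne t → t v ≡ false → BipartiteSet S → BipartiteSet (replaceStar S v t)
  bipartite-replaceStar one t-v (c , proper) = c⁺ , proper⁺
    where
    opposite : Σ Bool λ b → ∀ k → t k ≡ true → b ≢ c k
    opposite with any? (λ k → t k Bool.≟ true)
    ... | yes (k , tk) = not (c k) , λ k′ tk′ eq → not-¬ (cong c (one tk′ tk)) (sym eq)
    ... | no  none     = false , λ k tk → ⊥-elim (none (k , tk))

    c⁺ : Fin n → Bool
    c⁺ = updateAt c v (λ _ → proj₁ opposite)

    c⁺-other : ∀ {i} → i ≢ v → c⁺ i ≡ c i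
    c⁺-other {i} i≢v = updateAt-minimal i v c i≢v

    c⁺-star : ∀ {j} → t j ≡ true → c⁺ v ≢ c⁺ j
    c⁺-star {j} tj eq with toSum (j Fin.≟ v)
    ... | inj₁ refl = case trans (sym t-v) tj of λ ()
    ... | inj₂ j≢v  = proj₂ opposite j tj (trans (sym (updateAt-updates v c)) (trans eq (c⁺-other j≢v)))

    proper⁺ : ∀ i j → replaceStar S v t i j ≡ true → c⁺ i ≢ c⁺ j
    proper⁺ i j e with toSum (i Fin.≟ v) | toSum (j Fin.≟ v)
    ... | inj₁ refl | _         = c⁺-star (trans (sym (replaceStar-row j)) e)
    ... | inj₂ _    | inj₁ refl = c⁺-star (trans (sym (replaceStar-col i)) e) ∘ sym
    ... | inj₂ i≢v  | inj₂ j≢v  = λ eq →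
      proper i j (trans (sym (replaceStar-off i≢v j≢v)) e) (trans (sym (c⁺-other i≢v)) (trans eq (c⁺-other j≢v)))

  acyclic-replaceStar : AtMostOne t → AcyclicSet S → AcyclicSet (replaceStar S v t)
  acyclic-replaceStar one acyclic vs cycle with v ∈? vs
    where open DecMembership (Fin._≟_ {n}) using (_∈?_)
  ... | yes v∈vs =
    let x , y , x≢y , vx , yv = cycle-neighbours cycle v∈vs in
    x≢y (one (trans (sym (replaceStar-row x)) vx) (trans (sym (replaceStar-col y)) yv))
  ... | no v∉vs =
    acyclic vs (IsCycleIn-mono (λ i∈ j∈ e → trans (sym (replaceStar-off (avoids i∈) (avoids j∈))) e) cycle)
    where
    avoids : ∀ {i} → i ∈ vs → i ≢ v
    avoids i∈ refl = v∉vs i∈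

HasNegationSetWith : ∀ {n} → (EdgeSet n → Set) → Adj n → Set
HasNegationSetWith Good g = ∃ λ S → IsNegationSet g S × Good S

Antitone : ∀ {n} → (EdgeSet n → Set) → Set
Antitone Good = ∀ {S T} → S ⊆ₑ T → Good T → Good S

negationSet-restrict : ∀ {n} (Γ : SignedGraph n) (U : VSet n) {Good} → Antitone Good →
                       HasNegationSetWith Good (adj Γ) → HasNegationSetWith Good (restrict U (adj Γ))
negationSet-restrict Γ U antitone (S , ((S-sym , S-edges) , balanced) , good) =
  restrictSet U S ,
  (restrictSet-edgeSet {U = U} (S-sym , S-edges) ,
   potential⇒balanced (potential-resp (λ i j → sym (negateSet-restrictSet {U = U} {S} {adj Γ} i j))
                                      (potential-restrict {U = U} {adj (negateGraph S S-sym Γ)} P))) ,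
  antitone (restrictSet-⊆ {U = U}) good
  where
  P = Walks.balanced⇒potential (negateGraph S S-sym Γ) balanced

-- Undoing the deletions

length-filterᵇ-split : ∀ {A : Set} (P Q : A → Bool) xs →
  length (filterᵇ P xs) ≡ length (filterᵇ (λ x → P x ∧ Q x) xs) + length (filterᵇ (λ x → P x ∧ not (Q x)) xs)
length-filterᵇ-split P Q []       = refl
length-filterᵇ-split P Q (x ∷ xs) with P x | Q x
... | false | _     = length-filterᵇ-split P Q xs
... | true  | true  = cong suc (length-filterᵇ-split P Q xs)
... | true  | false = trans (cong suc (length-filterᵇ-split P Q xs)) (sym (+-suc _ _))

length≤1-∈ : ∀ {A : Set} {xs : List A} {x y} → length xs ≤ 1 → x ∈ xs → y ∈ xs → x ≡ y
length≤1-∈ {xs = _ ∷ []}    _        (here refl) (here refl) = refl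
length≤1-∈ {xs = _ ∷ _ ∷ _} (s≤s ()) _           _

count≤1⇒AtMostOne : ∀ {n} (t : Fin n → Bool) → length (filterᵇ t (allFin n)) ≤ 1 → AtMostOne t
count≤1⇒AtMostOne t ≤1 {a} {b} ta tb =
  length≤1-∈ ≤1 (∈-filter⁺ (T? ∘ t) (∈-allFin a) (Equivalence.from T-≡ ta))
                (∈-filter⁺ (T? ∘ t) (∈-allFin b) (Equivalence.from T-≡ tb))

sum<4⇒≤1 : ∀ a b → a + b < 4 → a ≤ 1 ⊎ b ≤ 1
sum<4⇒≤1 0             b _                   = inj₁ z≤n
sum<4⇒≤1 1             b _                   = inj₁ (s≤s z≤n)
sum<4⇒≤1 (suc (suc a)) b (s≤s (s≤s (s≤s h))) = inj₂ (m+n≤o⇒n≤o a h)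

module Deletion {n} (Γ : SignedGraph n) {V : VSet n} {v : Fin n} (v∈V : V v ≡ true)
                (deg<4 : deg (adj Γ) V v < 4)
                {S : EdgeSet n} (S-edges : IsEdgeSetOf (restrict (remove V v) (adj Γ)) S)
                (P : Potential (negateSet S (restrict (remove V v) (adj Γ)))) where

  open Potential P renaming (pot to p)

  neighbour : Fin n → Bool
  neighbour w = V w ∧ is-just (adj Γ v w)

  neighbour-edge : ∀ {j} → neighbour j ≡ true → HasEdge (restrict V (adj Γ)) v j
  neighbour-edge nj =
    let Vj , vj = ∧-true⁻ nj in
    λ e → is-just⇒≢nothing vj (trans (sym (restrict-inside {U = V} {adj Γ} v∈V Vj)) e)

  desired : Fin n → Sign
  desired w = edgeSign (adj Γ v w) · p w

  conflicts : Sign → Fin n → Bool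
  conflicts x w = neighbour w ∧ differs x (desired w)

  -- Each neighbour w asks for p⁺ v = desired w; as v has at most three neighbours, one of
  -- the two values is refused by at most one of them.
  consensus : Σ Sign λ x → AtMostOne (conflicts x)
  consensus
    with sum<4⇒≤1 _ _ (subst (_< 4) (length-filterᵇ-split neighbour (isMinus ∘ desired) (allFin n)) deg<4)
  ... | inj₁ few = plus  , count≤1⇒AtMostOne (conflicts plus) few
  ... | inj₂ few = minus , count≤1⇒AtMostOne (conflicts minus) few

  x : Sign
  x = proj₁ consensus

  S⁺ : EdgeSet n
  S⁺ = replaceStar S v (conflicts x)

  open StarReplacement S v (conflicts x)

  p⁺ : Fin n → Sign
  p⁺ = updateAt p v (λ _ → x)

  no-conflict-at-v : conflicts x v ≡ false
  no-conflict-at-v rewrite irrefl Γ v | ∧-zeroʳ (V v) = refl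

  S⁺-edges : IsEdgeSetOf (restrict V (adj Γ)) S⁺
  S⁺-edges = replaceStar-sym (proj₁ S-edges) , edges
    where
    edges : ∀ i j → S⁺ i j ≡ true → HasEdge (restrict V (adj Γ)) i j
    edges i j e with toSum (i Fin.≟ v) | toSum (j Fin.≟ v)
    ... | inj₁ refl | _         = neighbour-edge (proj₁ (∧-true⁻ (trans (sym (replaceStar-row j)) e)))
    ... | inj₂ _    | inj₁ refl = λ iv →
      neighbour-edge (proj₁ (∧-true⁻ (trans (sym (replaceStar-col i)) e)))
                     (trans (SignedGraph.sym (restrictGraph V Γ) v i) iv)
    ... | inj₂ i≢v  | inj₂ j≢v  = λ ij →
      proj₂ S-edges i j (trans (sym (replaceStar-off i≢v j≢v)) e) (trans (restrict-remove {V = V} {g = adj Γ} i≢v j≢v) ij)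

  Γ⁺ : SignedGraph n
  Γ⁺ = negateGraph S⁺ (proj₁ S⁺-edges) (restrictGraph V Γ)

  star-potential : ∀ {j} → HasEdge (adj Γ⁺) v j → edgeSign (adj Γ⁺ v j) ≡ x · p j
  star-potential {j} h = begin
    edgeSign (adj Γ⁺ v j)                                   ≡⟨ edgeSign-negateIf (S⁺ v j) vj ⟩
    signOf (S⁺ v j) · edgeSign (restrict V (adj Γ) v j)     ≡⟨ cong₂ (λ b m → signOf b · edgeSign m) conflict restricted ⟩
    signOf (differs x (desired j)) · edgeSign (adj Γ v j)   ≡⟨ cong (_· edgeSign (adj Γ v j)) (signOf-differs x (desired j)) ⟩
    (x · desired j) · edgeSign (adj Γ v j)                  ≡⟨ xsp·s≡xp x (edgeSign (adj Γ v j)) (p j) ⟩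
    x · p j                                                 ∎
    where
    open ≡-Reasoning
    vj = negateIf-edge (S⁺ v j) h
    restricted = proj₂ (restrict-edge {U = V} {adj Γ} vj)
    j-neighbour : neighbour j ≡ true
    j-neighbour = cong₂ _∧_ (proj₂ (∧-true⁻ (proj₁ (restrict-edge {U = V} {adj Γ} vj))))
                            (≢nothing⇒is-just λ e → vj (trans restricted e))
    conflict : S⁺ v j ≡ differs x (desired j)
    conflict = trans (replaceStar-row j) (cong (_∧ differs x (desired j)) j-neighbour)

  potential⁺ : Potential (adj Γ⁺)
  potential⁺ = record { pot = p⁺ ; consistent = consistent⁺ }
    where
    consistent⁺ : ∀ i j → HasEdge (adj Γ⁺) i j → edgeSign (adj Γ⁺ i j) ≡ p⁺ i · p⁺ j
    consistent⁺ i j h with toSum (i Fin.≟ v) | toSum (j Fin.≟ v)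
    ... | inj₁ refl | inj₁ refl = ⊥-elim (h (irrefl Γ⁺ v))
    ... | inj₁ refl | inj₂ j≢v  =
      trans (star-potential h) (sym (cong₂ _·_ (updateAt-updates v p) (updateAt-minimal j v p j≢v)))
    ... | inj₂ i≢v  | inj₁ refl =
      trans (cong edgeSign (SignedGraph.sym Γ⁺ i v))
        (trans (star-potential (λ e → h (trans (SignedGraph.sym Γ⁺ i v) e)))
          (trans (·-comm x (p i)) (sym (cong₂ _·_ (updateAt-minimal i v p i≢v) (updateAt-updates v p)))))
    ... | inj₂ i≢v  | inj₂ j≢v  =
      trans (cong edgeSign off) (trans (consistent i j λ e → h (trans off e))
        (sym (cong₂ _·_ (updateAt-minimal i v p i≢v) (updateAt-minimal j v p j≢v))))
      where
      off : adj Γ⁺ i j ≡ negateSet S (restrict (remove V v) (adj Γ)) i j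
      off = cong₂ negateIf (replaceStar-off i≢v j≢v) (sym (restrict-remove {V = V} {g = adj Γ} i≢v j≢v))

PendantClosed : ∀ {n} → (EdgeSet n → Set) → Set
PendantClosed Good = ∀ S v t → AtMostOne t → t v ≡ false → Good S → Good (replaceStar S v t)

module _ {n} (Γ : SignedGraph n) {Good : EdgeSet n → Set} (closed : PendantClosed Good) where

  negationSet-undelete : ∀ {V W} → DelStep (adj Γ) V W →
                         HasNegationSetWith Good (restrict W (adj Γ)) → HasNegationSetWith Good (restrict V (adj Γ))
  negationSet-undelete (del V v v∈V deg<4) (S , ((S-sym , S-edges) , balanced) , good) =
    S⁺ , (S⁺-edges , potential⇒balanced potential⁺) , closed S v (conflicts x) (proj₂ consensus) no-conflict-at-v good
    where
    open Deletion Γ v∈V deg<4 (S-sym , S-edges)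
           (Walks.balanced⇒potential (negateGraph S S-sym (restrictGraph (remove V v) Γ)) balanced)

  negationSet-undeleteAll : ∀ {V W} → Star (DelStep (adj Γ)) V W →
                            HasNegationSetWith Good (restrict W (adj Γ)) → HasNegationSetWith Good (restrict V (adj Γ))
  negationSet-undeleteAll ε               = λ has → has
  negationSet-undeleteAll (step ◅ steps) = negationSet-undelete step ∘ negationSet-undeleteAll steps

bipartite-pendantClosed : ∀ {n} → PendantClosed (BipartiteSet {n})
bipartite-pendantClosed S v t = StarReplacement.bipartite-replaceStar S v t

acyclic-pendantClosed : ∀ {n} → PendantClosed (AcyclicSet {n})
acyclic-pendantClosed S v t one _ = StarReplacement.acyclic-replaceStar S v t one

lemma4p4 : ∀ {n} (Σg : SignedGraph n) (U : VSet n) → IsFourCore (adj Σg) U →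
    (HasBipartiteNegationSet (adj Σg) ⇔ HasBipartiteNegationSet (restrict U (adj Σg)))
    × (HasAcyclicNegationSet (adj Σg) ⇔ HasAcyclicNegationSet (restrict U (adj Σg)))
-- The deletions start from allV, and restrict allV g computes to g.
lemma4p4 Σg U (deletions , _) =
  mk⇔ (negationSet-restrict Σg U bipartite-antitone) (negationSet-undeleteAll Σg bipartite-pendantClosed deletions) ,
  mk⇔ (negationSet-restrict Σg U acyclic-antitone)   (negationSet-undeleteAll Σg acyclic-pendantClosed deletions)
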